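{- Let $a$ and $b$ be positive integers. If $a\equiv 1$ or $2 \pmod 4$, then $2+2\mathbf{i}$ is not expressible as a sum of two squares of elements of $Q_{a,b}$. If $a\equiv 0$ or $3\pmod 4$, then $4+2\mathbf{i}$ is not expressible as a sum of two squares of elements of $Q_{a,b}$.
   Context: For positive integers $a,b$, let $Q_{a,b}=\{\alpha_0+\alpha_1\mathbf{i}+\alpha_2\mathbf{j}+\alpha_3\mathbf{k} : \alpha_0,\alpha_1,\alpha_2,\alpha_3\in\mathbb{Z}\}$ be the quaternion ring with $\mathbf{i}^2=-a$, $\mathbf{j}^2=-b$, $\mathbf{i}\mathbf{j}=-\mathbf{j}\mathbf{i}=\mathbf{k}$ (so $\mathbf{k}^2=-ab$). -}

module Defs where

open import Data.Integer using (ℤ; _+_; _-_; _*_; +_; 0ℤ)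

-- Elements α₀ + α₁ i + α₂ j + α₃ k of Q_{a,b}, with α₀,…,α₃ ∈ ℤ.
record Quat : Set where
  constructor quat
  field
    re : ℤ
    ci : ℤ
    cj : ℤ
    ck : ℤ

open Quat public

-- Multiplication in Q_{a,b}: i² = -a, j² = -b, ij = -ji = k, hence
-- k² = -ab, ik = -a j, ki = a j, jk = b i, kj = -b i.
mulQ : ℤ → ℤ → Quat → Quat → Quat
mulQ a b (quat x0 x1 x2 x3) (quat y0 y1 y2 y3) =
  quat (x0 * y0 - a * (x1 * y1) - b * (x2 * y2) - (a * b) * (x3 * y3))
       (x0 * y1 + x1 * y0 + b * (x2 * y3 - x3 * y2))
       (x0 * y2 + x2 * y0 + a * (x3 * y1 - x1 * y3))
       (x0 * y3 + x3 * y0 + x1 * y2 - x2 * y1)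

addQ : Quat → Quat → Quat
addQ (quat x0 x1 x2 x3) (quat y0 y1 y2 y3) =
  quat (x0 + y0) (x1 + y1) (x2 + y2) (x3 + y3)

sqQ : ℤ → ℤ → Quat → Quat
sqQ a b x = mulQ a b x x

_+_𝐢 : ℤ → ℤ → Quat
r0 + r1 𝐢 = quat r0 r1 0ℤ 0ℤ

-- Write x = x₀ + x₁i + x₂j + x₃k and y likewise. Comparing the i, j, k coefficients of
-- x² + y² = c + 2i gives x₀x₁ + y₀y₁ = 1 and (x₂, y₂), (x₃, y₃) ⊥ (x₀, y₀); since (x₀, y₀) has
-- the dual vector (x₁, y₁), this forces (x₂, y₂) = t(y₀, −x₀) and (x₃, y₃) = s(y₀, −x₀).
-- With n = x₀² + y₀² and m = x₁² + y₁² the real part becomes n(1 − bt² − abs²) = c + am, and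
-- as c > 0 the factor 1 − bt² − abs² must be 1, so n = c + am. The two-square identity turns
-- x₀x₁ + y₀y₁ = 1 into nm = 1 + d², hence (c + am)m = 1 + d². Modulo 4 the right side is 1 or 2,
-- whereas for c = 2, a ≡ 1, 2 and for c = 4, a ≡ 0, 3 the left side is 0 or 3.

module Submission where

open import Defs
open import Data.Nat using (ℕ; _%_; _≤_)
open import Data.Integer using (+_)
open import Data.Product using (_×_; ∃₂)
open import Data.Sum using (_⊎_)
open import Relation.Nullary using (¬_)
open import Relation.Binary.PropositionalEquality using (_≡_)

open import Data.Nat as ℕ using (zero; suc; s≤s; NonZero)
open import Data.Nat.DivMod using (%-distribˡ-+; %-distribˡ-*; m%n%n≡m%n; m%n<n)
open import Data.Integer using (-[1+_]; 0ℤ; 1ℤ; ∣_∣; -_)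
import Data.Integer.Properties as ℤP
import Data.Integer.Tactic.RingSolver as ℤ-Solver
open import Data.Product using (_,_; proj₁; proj₂)
open import Data.Sum using (inj₁; inj₂)
open import Data.Empty using (⊥-elim)
open import Relation.Binary.PropositionalEquality
  using (refl; sym; trans; cong; cong₂; subst; module ≡-Reasoning)

module Residues where

  open import Data.Nat using (_+_; _*_)
  open ≡-Reasoning

  module _ (d : ℕ) .{{_ : NonZero d}} where

    +-congʳ-% : ∀ m {n n′} → n % d ≡ n′ % d → (m + n) % d ≡ (m + n′) % d
    +-congʳ-% m {n} {n′} n≈n′ = begin
      (m + n) % d            ≡⟨ %-distribˡ-+ m n d ⟩
      (m % d + n % d) % d    ≡⟨ cong (λ v → (m % d + v) % d) n≈n′ ⟩
      (m % d + n′ % d) % d   ≡⟨ %-distribˡ-+ m n′ d ⟨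
      (m + n′) % d           ∎

    *-cong-% : ∀ {m m′ n n′} → m % d ≡ m′ % d → n % d ≡ n′ % d → (m * n) % d ≡ (m′ * n′) % d
    *-cong-% {m} {m′} {n} {n′} m≈m′ n≈n′ = begin
      (m * n) % d            ≡⟨ %-distribˡ-* m n d ⟩
      (m % d * (n % d)) % d  ≡⟨ cong₂ (λ u v → (u * v) % d) m≈m′ n≈n′ ⟩
      (m′ % d * (n′ % d)) % d ≡⟨ %-distribˡ-* m′ n′ d ⟨
      (m′ * n′) % d          ∎

    reduce-% : ∀ m → m % d ≡ (m % d) % d
    reduce-% m = sym (m%n%n≡m%n m d)

    [n+am]m-% : ∀ n a m → ((n + a * m) * m) % d ≡ ((n + a % d * (m % d)) * (m % d)) % d
    [n+am]m-% n a m =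
      *-cong-% (+-congʳ-% n (*-cong-% (reduce-% a) (reduce-% m))) (reduce-% m)

  mod-4-cases : (P : ℕ → Set) → P 0 → P 1 → P 2 → P 3 → ∀ m → P (m % 4)
  mod-4-cases P p₀ p₁ p₂ p₃ m with m % 4 | m%n<n m 4
  ... | 0 | _ = p₀
  ... | 1 | _ = p₁
  ... | 2 | _ = p₂
  ... | 3 | _ = p₃
  ... | suc (suc (suc (suc _))) | s≤s (s≤s (s≤s (s≤s ())))

  ZeroOrThree OneOrTwo : ℕ → Set
  ZeroOrThree r = r ≡ 0 ⊎ r ≡ 3
  OneOrTwo r = r ≡ 1 ⊎ r ≡ 2

  1+square-% : ∀ d → OneOrTwo ((1 + d * d) % 4)
  1+square-% d = subst OneOrTwo (sym reduced)
    (mod-4-cases (λ r → OneOrTwo ((1 + r * r) % 4)) (inj₁ refl) (inj₂ refl) (inj₁ refl) (inj₂ refl) d)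
    where
    reduced : (1 + d * d) % 4 ≡ (1 + d % 4 * (d % 4)) % 4
    reduced = +-congʳ-% 4 1 {d * d} {d % 4 * (d % 4)} (%-distribˡ-* d d 4)

  [2+am]m-% : ∀ a → a % 4 ≡ 1 ⊎ a % 4 ≡ 2 → ∀ m → ZeroOrThree (((2 + a * m) * m) % 4)
  [2+am]m-% a a≡ m = subst ZeroOrThree (sym ([n+am]m-% 4 2 a m)) (residues a≡)
    where
    residues : a % 4 ≡ 1 ⊎ a % 4 ≡ 2 → ZeroOrThree (((2 + a % 4 * (m % 4)) * (m % 4)) % 4)
    residues (inj₁ a≡1) rewrite a≡1 = mod-4-cases (λ r → ZeroOrThree (((2 + 1 * r) * r) % 4))
      (inj₁ refl) (inj₂ refl) (inj₁ refl) (inj₂ refl) m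
    residues (inj₂ a≡2) rewrite a≡2 = mod-4-cases (λ r → ZeroOrThree (((2 + 2 * r) * r) % 4))
      (inj₁ refl) (inj₁ refl) (inj₁ refl) (inj₁ refl) m

  [4+am]m-% : ∀ a → a % 4 ≡ 0 ⊎ a % 4 ≡ 3 → ∀ m → ZeroOrThree (((4 + a * m) * m) % 4)
  [4+am]m-% a a≡ m = subst ZeroOrThree (sym ([n+am]m-% 4 4 a m)) (residues a≡)
    where
    residues : a % 4 ≡ 0 ⊎ a % 4 ≡ 3 → ZeroOrThree (((4 + a % 4 * (m % 4)) * (m % 4)) % 4)
    residues (inj₁ a≡0) rewrite a≡0 = mod-4-cases (λ r → ZeroOrThree (((4 + 0 * r) * r) % 4))
      (inj₁ refl) (inj₁ refl) (inj₁ refl) (inj₁ refl) m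
    residues (inj₂ a≡3) rewrite a≡3 = mod-4-cases (λ r → ZeroOrThree (((4 + 3 * r) * r) % 4))
      (inj₁ refl) (inj₂ refl) (inj₁ refl) (inj₂ refl) m

  no-solution-% : ∀ n a → (∀ m → ZeroOrThree (((n + a * m) * m) % 4)) →
    ¬ ∃₂ λ m d → (n + a * m) * m ≡ 1 + d * d
  no-solution-% n a lhs (m , d , eq) =
    disjoint (lhs m) (subst OneOrTwo (cong (_% 4) (sym eq)) (1+square-% d))
    where
    disjoint : ∀ {r} → ZeroOrThree r → ¬ OneOrTwo r
    disjoint (inj₁ refl) (inj₁ ())
    disjoint (inj₁ refl) (inj₂ ())
    disjoint (inj₂ refl) (inj₁ ())
    disjoint (inj₂ refl) (inj₂ ())

open Residues using ([2+am]m-%; [4+am]m-%; no-solution-%)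

open import Data.Integer using (_+_; _*_; _-_)

orthogonal-complement : ∀ x₀ y₀ x₁ y₁ u v → x₀ * x₁ + y₀ * y₁ ≡ 1ℤ → x₀ * u + y₀ * v ≡ 0ℤ →
  u ≡ y₀ * (y₁ * u - x₁ * v) × v ≡ - (x₀ * (y₁ * u - x₁ * v))
orthogonal-complement x₀ y₀ x₁ y₁ u v dual orth =
  solve-for u x₁ (expand-u x₀ y₀ x₁ y₁ u v) , solve-for v y₁ (expand-v x₀ y₀ x₁ y₁ u v)
  where
  open ≡-Reasoning
  expand-u : ∀ a b c d u v → u * (a * c + b * d) ≡ b * (d * u - c * v) + c * (a * u + b * v)
  expand-u = ℤ-Solver.solve-∀
  expand-v : ∀ a b c d u v → v * (a * c + b * d) ≡ - (a * (d * u - c * v)) + d * (a * u + b * v)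
  expand-v = ℤ-Solver.solve-∀
  solve-for : ∀ w z {r} → w * (x₀ * x₁ + y₀ * y₁) ≡ r + z * (x₀ * u + y₀ * v) → w ≡ r
  solve-for w z {r} expansion = begin
    w                            ≡⟨ ℤP.*-identityʳ w ⟨
    w * 1ℤ                       ≡⟨ cong (w *_) dual ⟨
    w * (x₀ * x₁ + y₀ * y₁)      ≡⟨ expansion ⟩
    r + z * (x₀ * u + y₀ * v)    ≡⟨ cong (λ e → r + z * e) orth ⟩
    r + z * 0ℤ                   ≡⟨ cong (λ e → r + e) (ℤP.*-zeroʳ z) ⟩
    r + 0ℤ                       ≡⟨ ℤP.+-identityʳ r ⟩
    r                            ∎

imaginary-parts : ∀ A B x₀ x₁ x₂ x₃ y₀ y₁ y₂ y₃ →
  let q = addQ (sqQ A B (quat x₀ x₁ x₂ x₃)) (sqQ A B (quat y₀ y₁ y₂ y₃)) in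
  ci q ≡ + 2 * (x₀ * x₁ + y₀ * y₁) × cj q ≡ + 2 * (x₀ * x₂ + y₀ * y₂) × ck q ≡ + 2 * (x₀ * x₃ + y₀ * y₃)
imaginary-parts A B x₀ x₁ x₂ x₃ y₀ y₁ y₂ y₃ =
  cross B x₀ x₁ x₂ x₃ y₀ y₁ y₂ y₃ , cross A x₀ x₂ x₃ x₁ y₀ y₂ y₃ y₁ , cross-k x₀ x₃ x₁ x₂ y₀ y₃ y₁ y₂
  where
  cross : ∀ C p x y z p′ x′ y′ z′ →
    (p * x + x * p + C * (y * z - z * y)) + (p′ * x′ + x′ * p′ + C * (y′ * z′ - z′ * y′))
      ≡ + 2 * (p * x + p′ * x′)
  cross = ℤ-Solver.solve-∀
  cross-k : ∀ p x y z p′ x′ y′ z′ →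
    (p * x + x * p + y * z - z * y) + (p′ * x′ + x′ * p′ + y′ * z′ - z′ * y′) ≡ + 2 * (p * x + p′ * x′)
  cross-k = ℤ-Solver.solve-∀

real-part-orthogonal : ∀ A B x₀ x₁ x₂ x₃ y₀ y₁ y₂ y₃ t s →
  x₂ ≡ y₀ * t → y₂ ≡ - (x₀ * t) → x₃ ≡ y₀ * s → y₃ ≡ - (x₀ * s) →
  re (addQ (sqQ A B (quat x₀ x₁ x₂ x₃)) (sqQ A B (quat y₀ y₁ y₂ y₃))) + A * (x₁ * x₁ + y₁ * y₁)
    ≡ (x₀ * x₀ + y₀ * y₀) * (1ℤ - (B * (t * t) + A * B * (s * s)))
real-part-orthogonal A B x₀ x₁ _ _ y₀ y₁ _ _ t s refl refl refl refl = expand A B x₀ y₀ x₁ y₁ t s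
  where
  expand : ∀ A B x₀ y₀ x₁ y₁ t s →
    (x₀ * x₀ - A * (x₁ * x₁) - B * ((y₀ * t) * (y₀ * t)) - (A * B) * ((y₀ * s) * (y₀ * s)))
      + (y₀ * y₀ - A * (y₁ * y₁) - B * (- (x₀ * t) * - (x₀ * t)) - (A * B) * (- (x₀ * s) * - (x₀ * s)))
      + A * (x₁ * x₁ + y₁ * y₁)
    ≡ (x₀ * x₀ + y₀ * y₀) * (1ℤ - (B * (t * t) + A * B * (s * s)))
  expand = ℤ-Solver.solve-∀

two-squares-identity : ∀ x₀ y₀ x₁ y₁ → (x₀ * x₀ + y₀ * y₀) * (x₁ * x₁ + y₁ * y₁)
  ≡ (x₀ * x₁ + y₀ * y₁) * (x₀ * x₁ + y₀ * y₁) + (x₀ * y₁ - y₀ * x₁) * (x₀ * y₁ - y₀ * x₁)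
two-squares-identity = ℤ-Solver.solve-∀

representation⇒norm-equations : ∀ A B c x y → addQ (sqQ A B x) (sqQ A B y) ≡ c + (+ 2) 𝐢 →
  let n = re x * re x + re y * re y
      m = ci x * ci x + ci y * ci y
      d = re x * ci y - re y * ci x
  in ∃₂ λ t s → n * (1ℤ - (B * (t * t) + A * B * (s * s))) ≡ c + A * m × n * m ≡ 1ℤ + d * d
representation⇒norm-equations A B c (quat x₀ x₁ x₂ x₃) (quat y₀ y₁ y₂ y₃) eq =
  t , s , factorised , norm-product
  where
  open ≡-Reasoning
  q = addQ (sqQ A B (quat x₀ x₁ x₂ x₃)) (sqQ A B (quat y₀ y₁ y₂ y₃))
  halve : ∀ {e f} → + 2 * e ≡ + 2 * f → e ≡ f
  halve = ℤP.*-cancelˡ-≡ (+ 2) _ _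
  parts = imaginary-parts A B x₀ x₁ x₂ x₃ y₀ y₁ y₂ y₃
  i-part : ci q ≡ + 2 * (x₀ * x₁ + y₀ * y₁)
  i-part = proj₁ parts
  j-part : cj q ≡ + 2 * (x₀ * x₂ + y₀ * y₂)
  j-part = proj₁ (proj₂ parts)
  k-part : ck q ≡ + 2 * (x₀ * x₃ + y₀ * y₃)
  k-part = proj₂ (proj₂ parts)
  dual : x₀ * x₁ + y₀ * y₁ ≡ 1ℤ
  dual = halve (trans (sym i-part) (cong ci eq))
  t = y₁ * x₂ - x₁ * y₂
  s = y₁ * x₃ - x₁ * y₃
  x₂≡ : x₂ ≡ y₀ * t × y₂ ≡ - (x₀ * t)
  x₂≡ = orthogonal-complement x₀ y₀ x₁ y₁ x₂ y₂ dual (halve (trans (sym j-part) (cong cj eq)))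
  x₃≡ : x₃ ≡ y₀ * s × y₃ ≡ - (x₀ * s)
  x₃≡ = orthogonal-complement x₀ y₀ x₁ y₁ x₃ y₃ dual (halve (trans (sym k-part) (cong ck eq)))
  factorised : (x₀ * x₀ + y₀ * y₀) * (1ℤ - (B * (t * t) + A * B * (s * s))) ≡ c + A * (x₁ * x₁ + y₁ * y₁)
  factorised = begin
    (x₀ * x₀ + y₀ * y₀) * (1ℤ - (B * (t * t) + A * B * (s * s)))
      ≡⟨ real-part-orthogonal A B x₀ x₁ x₂ x₃ y₀ y₁ y₂ y₃ t s (proj₁ x₂≡) (proj₂ x₂≡) (proj₁ x₃≡) (proj₂ x₃≡) ⟨
    re q + A * (x₁ * x₁ + y₁ * y₁)
      ≡⟨ cong (λ r → r + A * (x₁ * x₁ + y₁ * y₁)) (cong re eq) ⟩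
    c + A * (x₁ * x₁ + y₁ * y₁) ∎
  norm-product : (x₀ * x₀ + y₀ * y₀) * (x₁ * x₁ + y₁ * y₁) ≡ 1ℤ + (x₀ * y₁ - y₀ * x₁) * (x₀ * y₁ - y₀ * x₁)
  norm-product = trans (two-squares-identity x₀ y₀ x₁ y₁)
    (cong (λ e → e * e + (x₀ * y₁ - y₀ * x₁) * (x₀ * y₁ - y₀ * x₁)) dual)

i*i≡+∣i∣*∣i∣ : ∀ i → i * i ≡ + (∣ i ∣ ℕ.* ∣ i ∣)
i*i≡+∣i∣*∣i∣ (+ n) = sym (ℤP.pos-* n n)
i*i≡+∣i∣*∣i∣ -[1+ n ] = refl

sum-of-squares-nonNeg : ∀ i j → i * i + j * j ≡ + (∣ i ∣ ℕ.* ∣ i ∣ ℕ.+ ∣ j ∣ ℕ.* ∣ j ∣)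
sum-of-squares-nonNeg i j = trans (cong₂ _+_ (i*i≡+∣i∣*∣i∣ i) (i*i≡+∣i∣*∣i∣ j))
  (sym (ℤP.pos-+ (∣ i ∣ ℕ.* ∣ i ∣) (∣ j ∣ ℕ.* ∣ j ∣)))

weighted-squares-nonNeg : ∀ a b t s →
  + b * (t * t) + + a * + b * (s * s) ≡ + (b ℕ.* (∣ t ∣ ℕ.* ∣ t ∣) ℕ.+ a ℕ.* b ℕ.* (∣ s ∣ ℕ.* ∣ s ∣))
weighted-squares-nonNeg a b t s = begin
  + b * (t * t) + + a * + b * (s * s)   ≡⟨ cong₂ (λ u v → + b * u + + a * + b * v) (i*i≡+∣i∣*∣i∣ t) (i*i≡+∣i∣*∣i∣ s) ⟩
  + b * + T + + a * + b * + S           ≡⟨ cong (λ u → + b * + T + u * + S) (ℤP.pos-* a b) ⟨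
  + b * + T + + (a ℕ.* b) * + S         ≡⟨ cong₂ _+_ (ℤP.pos-* b T) (ℤP.pos-* (a ℕ.* b) S) ⟨
  + (b ℕ.* T) + + (a ℕ.* b ℕ.* S)       ≡⟨ ℤP.pos-+ (b ℕ.* T) (a ℕ.* b ℕ.* S) ⟨
  + (b ℕ.* T ℕ.+ a ℕ.* b ℕ.* S)         ∎
  where
  open ≡-Reasoning
  T = ∣ t ∣ ℕ.* ∣ t ∣
  S = ∣ s ∣ ℕ.* ∣ s ∣

n[1-k]≡1+c⇒n≡1+c : ∀ n k c → + n * (1ℤ - + k) ≡ + suc c → n ≡ suc c
n[1-k]≡1+c⇒n≡1+c n zero c eq = ℤP.+-injective (trans (sym (ℤP.*-identityʳ (+ n))) eq)
n[1-k]≡1+c⇒n≡1+c n (suc k) c eq = ⊥-elim (-+≢+suc (begin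
  - + (n ℕ.* k)              ≡⟨ cong -_ (ℤP.pos-* n k) ⟩
  - (+ n * + k)              ≡⟨ ℤP.neg-distribʳ-* (+ n) (+ k) ⟩
  + n * - + k                ≡⟨ cong (λ e → + n * e) (ℤP.1-[1+n]≡-n k) ⟨
  + n * (1ℤ - + suc k)       ≡⟨ eq ⟩
  + suc c                    ∎))
  where
  open ≡-Reasoning
  -+≢+suc : ∀ {x} → ¬ (- + x ≡ + suc c)
  -+≢+suc {zero} ()
  -+≢+suc {suc _} ()

norm-equations⇒ℕ-equation : ∀ a c {n m k e N M K E} → N ≡ + n → M ≡ + m → K ≡ + k → E ≡ + e →
  N * (1ℤ - K) ≡ + suc c + + a * M → N * M ≡ 1ℤ + E → (suc c ℕ.+ a ℕ.* m) ℕ.* m ≡ 1 ℕ.+ e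
norm-equations⇒ℕ-equation a c {n} {m} {k} refl refl refl refl factorised product =
  trans (cong (ℕ._* m) (sym n≡)) (ℤP.+-injective (trans (ℤP.pos-* n m) product))
  where
  n≡ : n ≡ suc c ℕ.+ a ℕ.* m
  n≡ = n[1-k]≡1+c⇒n≡1+c n k (c ℕ.+ a ℕ.* m) (trans factorised
    (trans (cong (λ e → + suc c + e) (sym (ℤP.pos-* a m))) (sym (ℤP.pos-+ (suc c) (a ℕ.* m)))))

representation⇒ℕ-equation : ∀ a b c x y →
  addQ (sqQ (+ a) (+ b) x) (sqQ (+ a) (+ b) y) ≡ (+ suc c) + (+ 2) 𝐢 →
  ∃₂ λ m d → (suc c ℕ.+ a ℕ.* m) ℕ.* m ≡ 1 ℕ.+ d ℕ.* d
representation⇒ℕ-equation a b c x y eq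
  with representation⇒norm-equations (+ a) (+ b) (+ suc c) x y eq
... | t , s , factorised , product = _ , ∣ re x * ci y - re y * ci x ∣ , norm-equations⇒ℕ-equation a c
  (sum-of-squares-nonNeg (re x) (re y)) (sum-of-squares-nonNeg (ci x) (ci y))
  (weighted-squares-nonNeg a b t s) (i*i≡+∣i∣*∣i∣ (re x * ci y - re y * ci x))
  factorised product

mainTheorem2 : (a b : ℕ) → 1 ≤ a → 1 ≤ b →
    ((a % 4 ≡ 1 ⊎ a % 4 ≡ 2) →
      ¬ (∃₂ λ x y → addQ (sqQ (+ a) (+ b) x) (sqQ (+ a) (+ b) y) ≡ (+ 2) + (+ 2) 𝐢))
    × ((a % 4 ≡ 0 ⊎ a % 4 ≡ 3) →
      ¬ (∃₂ λ x y → addQ (sqQ (+ a) (+ b) x) (sqQ (+ a) (+ b) y) ≡ (+ 4) + (+ 2) 𝐢))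
mainTheorem2 a b _ _ =
  (λ a≡1∨2 (x , y , eq) → no-solution-% 2 a ([2+am]m-% a a≡1∨2) (representation⇒ℕ-equation a b 1 x y eq)) ,
  (λ a≡0∨3 (x , y , eq) → no-solution-% 4 a ([4+am]m-% a a≡0∨3) (representation⇒ℕ-equation a b 3 x y eq))
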